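{- Let $n\ge1$ and $R_i$ be as in the context. For each $i\in\{ -n-1,\dots,n+1\}$, $-R_i={\sim}R_i$, where ${\sim}R=R^{c\smile}\circ\alpha$ and $-R=\alpha\circ R^{c\smile}$.
   Context: For $p=(p_1,\dots,p_n)\in\mathbb Q^n$: $(p,q)\in L_1$ iff $p_1<q_1$; for $2\le i\le n$, $(p,q)\in L_i$ iff $(p_1,\dots,p_{i-1})=(q_1,\dots,q_{i-1})$ and $p_i<q_i$. Let $<_n=L_1\cup\dots\cup L_n$. $X=\mathbb Q^n\times\{ -1,1\}$, writing $p^b$ for $(p,b)$, with $p^b\le_X q^d$ iff $p^b=q^d$ or $p<_nq$; $\alpha(p^b)=p^{ -b}$. For $R\subseteq X^2$, $R^c=X^2\setminus R$, $R^\smile$ the converse, $\circ$ relational composition. $U_j=\{(p^b,q^d)\mid b,d\in\{ -1,1\},(p,q)\in L_j\}$. $R_{ -n-1}=\varnothing$; $R_i=\bigcup_{j=1}^{n+1+i}U_j$ for $-n\le i\le-1$; $R_0={\le_X}$; $R_i=(R_{ -i})^{c\smile}\circ\alpha$ for $1\le i\le n+1$. -}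

module Defs where

open import Data.Nat as ℕ using (ℕ; zero; suc)
open import Data.Fin using (Fin; toℕ)
open import Data.Vec using (Vec; lookup)
open import Data.Rational as ℚ using (ℚ)
open import Data.Sign using (Sign) renaming (opposite to negSign)
open import Data.Integer as ℤ using (ℤ; +_; -[1+_])
open import Data.Product using (_×_; _,_; ∃)
open import Data.Sum using (_⊎_)
open import Data.Empty using (⊥)
open import Relation.Nullary using (¬_)
open import Relation.Binary.PropositionalEquality using (_≡_)

-- Points of ℚⁿ are vectors; coordinate j (1-based in the paper) is index j-1.
Pt : ℕ → Set
Pt n = Vec ℚ n

-- X = ℚⁿ × {-1,1}; the sign set {-1,1} is represented by Data.Sign.
X : ℕ → Set
X n = Pt n × Sign

Relation : ℕ → Set₁
Relation n = X n → X n → Set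

-- L_{j+1} for j : Fin n (0-based index): first j coordinates agree and p_{j+1} < q_{j+1}.
L : ∀ {n} → Fin n → Pt n → Pt n → Set
L {n} j p q = (∀ (k : Fin n) → toℕ k ℕ.< toℕ j → lookup p k ≡ lookup q k)
              × (lookup p j ℚ.< lookup q j)

_<ₙ_ : ∀ {n} → Pt n → Pt n → Set
_<ₙ_ {n} p q = ∃ λ (j : Fin n) → L j p q

≤X : ∀ {n} → Relation n
≤X x y = x ≡ y ⊎ (Data.Product.proj₁ x <ₙ Data.Product.proj₁ y)

α : ∀ {n} → X n → X n
α (p , b) = (p , negSign b)

-- U_{j+1} for j : Fin n (0-based)
U : ∀ {n} → Fin n → Relation n
U j (p , _) (q , _) = L j p q

_ᶜ : ∀ {n} → Relation n → Relation n
(R ᶜ) x y = ¬ R x y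

_˘ : ∀ {n} → Relation n → Relation n
(R ˘) x y = R y x

_∘ᵣ_ : ∀ {n} → Relation n → Relation n → Relation n
_∘ᵣ_ {n} R S x z = ∃ λ (y : X n) → R x y × S y z

αRel : ∀ {n} → Relation n
αRel x y = α x ≡ y

∼_ : ∀ {n} → Relation n → Relation n
∼ R = ((R ᶜ) ˘) ∘ᵣ αRel

-ᵣ_ : ∀ {n} → Relation n → Relation n
-ᵣ R = αRel ∘ᵣ ((R ᶜ) ˘)

_≐_ : ∀ {n} → Relation n → Relation n → Set
R ≐ S = ∀ x y → (R x y → S x y) × (S x y → R x y)

⋃U : ∀ {n} → ℕ → Relation n
⋃U {n} m x y = ∃ λ (j : Fin n) → (toℕ j ℕ.< m) × U j x y

∅ᵣ : ∀ {n} → Relation n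
∅ᵣ _ _ = ⊥

-- R_{-k} for k = 1 … n+1 :  R_{-(n+1)} = ∅, R_{-k} = ⋃_{j=1}^{n+1-k} U_j (1 ≤ k ≤ n)
Rneg : ∀ {n} → ℕ → Relation n
Rneg {n} k with k ℕ.≟ suc n
... | Relation.Nullary.yes _ = ∅ᵣ
... | Relation.Nullary.no _ = ⋃U (suc n ℕ.∸ k)

-- R_i for i ∈ ℤ (meaningful for -n-1 ≤ i ≤ n+1)
Rᵢ : ∀ {n} → ℤ → Relation n
Rᵢ (+ zero) = ≤X
Rᵢ (+ suc m) = ∼ (Rneg (suc m))
Rᵢ -[1+ m ] = Rneg (suc m)

{-# OPTIONS --safe #-}
module Submission where

open import Defs
open import Data.Nat using (ℕ; _≤_)
import Data.Nat as ℕ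
open import Data.Integer as ℤ using (ℤ; +_; -_)
open import Data.Product using (_,_)
open import Data.Sum using (inj₁; inj₂)
open import Data.Sign.Properties using (opposite-involutive)
open import Relation.Nullary using (yes; no)
open import Relation.Binary.PropositionalEquality using (_≡_; refl; cong; subst; subst₂)

-- Every Rᵢ commutes with the involution α (each is built from ≤X and the Uⱼ,
-- which ignore signs, by ∼, which preserves this property).  For any such R,
-- -R = α ∘ Rᶜ˘ and ∼R = Rᶜ˘ ∘ α coincide, since moving α across Rᶜ˘ is free.

α-involutive : ∀ {n} (x : X n) → α (α x) ≡ x
α-involutive (p , b) = cong (p ,_) (opposite-involutive b)

α-Invariant : ∀ {n} → Relation n → Set
α-Invariant {n} R = ∀ (x y : X n) → R x y → R (α x) (α y)

α-invariant-reflects : ∀ {n} {R : Relation n} → α-Invariant R →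
                       ∀ x y → R (α x) (α y) → R x y
α-invariant-reflects {R = R} inv x y r =
  subst₂ R (α-involutive x) (α-involutive y) (inv (α x) (α y) r)

α-invariant-transpose : ∀ {n} {R : Relation n} → α-Invariant R →
                        ∀ x y → R (α x) y → R x (α y)
α-invariant-transpose {R = R} inv x y r = subst (λ u → R u (α y)) (α-involutive x) (inv (α x) y r)

-ᵣ≐∼ : ∀ {n} {R : Relation n} → α-Invariant R → (-ᵣ R) ≐ (∼ R)
-ᵣ≐∼ {R = R} inv x z = to , from
  where
  to : (-ᵣ R) x z → (∼ R) x z
  to (_ , refl , ¬Rzαx) = α z , (λ Rαzx → ¬Rzαx (α-invariant-transpose inv z x Rαzx)) , α-involutive z
  from : (∼ R) x z → (-ᵣ R) x z
  from (y , ¬Ryx , refl) = α x , refl , λ Rαyαx → ¬Ryx (α-invariant-reflects inv y x Rαyαx)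

∼-α-invariant : ∀ {n} {R : Relation n} → α-Invariant R → α-Invariant (∼ R)
∼-α-invariant inv x _ (y , ¬Ryx , refl) =
  α y , (λ Rαyαx → ¬Ryx (α-invariant-reflects inv y x Rαyαx)) , refl

≤X-α-invariant : ∀ {n} → α-Invariant (≤X {n})
≤X-α-invariant _ _ (inj₁ refl) = inj₁ refl
≤X-α-invariant (_ , _) (_ , _) (inj₂ p<q) = inj₂ p<q

⋃U-α-invariant : ∀ {n} m → α-Invariant (⋃U {n} m)
⋃U-α-invariant m (_ , _) (_ , _) r = r

Rneg-α-invariant : ∀ {n} k → α-Invariant (Rneg {n} k)
Rneg-α-invariant {n} k with k ℕ.≟ ℕ.suc n
... | yes _ = λ _ _ ()
... | no _ = ⋃U-α-invariant (ℕ.suc n ℕ.∸ k)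

Rᵢ-α-invariant : ∀ {n} i → α-Invariant (Rᵢ {n} i)
Rᵢ-α-invariant (+ ℕ.zero) = ≤X-α-invariant
Rᵢ-α-invariant (+ ℕ.suc m) = ∼-α-invariant (Rneg-α-invariant (ℕ.suc m))
Rᵢ-α-invariant ℤ.-[1+ m ] = Rneg-α-invariant (ℕ.suc m)

lemma3p4 : (n : ℕ) → 1 ≤ n → (i : ℤ) → - (+ (n Data.Nat.+ 1)) ℤ.≤ i → i ℤ.≤ + (n Data.Nat.+ 1) →
    (-ᵣ (Rᵢ {n} i)) ≐ (∼ (Rᵢ {n} i))
lemma3p4 n _ i _ _ = -ᵣ≐∼ (Rᵢ-α-invariant i)
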